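{- For every graph $G$ with $n$ vertices there exists an extension of the edge polytope $P(G)$ of size $O(n^2/\log n)$.
   Context: The edge polytope $P(G)$ is the convex hull in $\mathbb{R}^{V(G)}$ of the incidence vectors of the edges of $G$. An extended formulation (extension) of a polytope $P\subseteq\mathbb{R}^d$ is a system of linear inequalities and equations defining a polyhedron $Q\subseteq\mathbb{R}^e$ together with an affine map $\pi$ with $\pi(Q)=P$; its size is the number of inequalities. The $O$ hides an absolute constant. -}

module Defs where

open import Data.Nat using (ℕ)
open import Data.Fin using (Fin; zero; suc)
open import Data.Bool using (Bool; true; false)
open import Data.Rational using (ℚ; 0ℚ; 1ℚ; _+_; _*_; _≤_)
open import Data.Product using (Σ; _×_; ∃)
open import Relation.Binary.PropositionalEquality using (_≡_)
open import Relation.Nullary using (yes; no)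
open import Data.Fin using (_≟_)
open import Function.Bundles using (_⇔_)

∑ : ∀ {n} → (Fin n → ℚ) → ℚ
∑ {ℕ.zero} f = 0ℚ
∑ {ℕ.suc n} f = f zero + ∑ (λ i → f (suc i))

record Graph (n : ℕ) : Set where
  field
    Adj    : Fin n → Fin n → Bool
    sym    : ∀ i j → Adj i j ≡ Adj j i
    irrefl : ∀ i → Adj i i ≡ false

χ : ∀ {n} → Fin n → Fin n → Fin n → ℚ
χ i j v with v ≟ i | v ≟ j
... | yes _ | _     = 1ℚ
... | no _  | yes _ = 1ℚ
... | no _  | no _  = 0ℚ

-- Membership of a (rational) point in the edge polytope P(G):
-- x is a convex combination of incidence vectors of edges of G.
-- (Coefficients indexed by ordered pairs (i,j) with Adj i j; each edge
-- may thus appear twice, which does not change the convex hull.)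
InEdgePolytope : ∀ {n} → Graph n → (Fin n → ℚ) → Set
InEdgePolytope {n} G x =
  Σ (Fin n → Fin n → ℚ) λ c →
    (∀ i j → 0ℚ ≤ c i j) ×
    (∀ i j → Graph.Adj G i j ≡ false → c i j ≡ 0ℚ) ×
    (∑ (λ i → ∑ (λ j → c i j)) ≡ 1ℚ) ×
    (∀ v → x v ≡ ∑ (λ i → ∑ (λ j → c i j * χ i j v)))

-- An extended formulation of a polytope in ℚ^d:
-- Q = { y ∈ ℚ^e : A y ≤ b , E y = f } with m inequalities and k equations,
-- and an affine map π(y) = T y + t.
record Extension (d : ℕ) : Set where
  field
    e m k : ℕ
    A : Fin m → Fin e → ℚ
    b : Fin m → ℚ
    E : Fin k → Fin e → ℚ
    f : Fin k → ℚ
    T : Fin d → Fin e → ℚ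
    t : Fin d → ℚ

  InQ : (Fin e → ℚ) → Set
  InQ y = (∀ r → ∑ (λ j → A r j * y j) ≤ b r) × (∀ r → ∑ (λ j → E r j * y j) ≡ f r)

  π : (Fin e → ℚ) → Fin d → ℚ
  π y v = ∑ (λ j → T v j * y j) + t v

  size : ℕ
  size = m

IsExtensionOf : ∀ {d} → Extension d → ((Fin d → ℚ) → Set) → Set
IsExtensionOf {d} X P =
  ∀ (x : Fin d → ℚ) → P x ⇔ (Σ (Fin (Extension.e X) → ℚ) λ y →
      Extension.InQ X y × (∀ v → Extension.π X y v ≡ x v))

-- Split the vertices into b ≈ n / k blocks of k ≈ (log₂ n) / 2 vertices.  The neighbourhood of a
-- vertex i inside a block s is one of only 2 ^ k ≈ √n bit patterns t, so the ordered edges of G are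
-- partitioned into the bicliques {i : i has pattern t in s} × {j ∈ s : t has j's bit set}.
-- A point of P(G) is then described by the weight out s i of the edges from i into block s and the
-- weight into t j of the edges into j coming from the pattern class t of j's block: nonnegative, of
-- total weight one, and balanced on the two sides of every biclique.  Conversely, each biclique
-- spreads a balanced flow over its edges proportionally to both sides, which gives back a convex
-- combination of edges.  That uses b·n + 2^k·n = O(n² / log n) variables, each only constrained
-- to be nonnegative.

module Submission where

open import Defs

module ExtendedFormulation where

  open import Data.Bool using (Bool; true; false; _∧_; T)
  open import Data.Empty using (⊥-elim)
  open import Data.Fin
    using (Fin; zero; suc; _↑ˡ_; _↑ʳ_; combine; splitAt; quotRem; remQuot; inject≤; funToFin; finToFun)
  open import Data.Fin.Properties
    using (_≟_; remQuot-combine; combine-remQuot; inject≤-injective; any?; 2↔Bool; finToFun-funToFin)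
  open import Data.Nat as ℕ using (ℕ; zero; suc)
  open import Data.Product using (Σ; _×_; _,_; proj₁; proj₂; uncurry; swap)
  open import Data.Rational as ℚ using (ℚ; 0ℚ; 1ℚ; _+_; _*_; -_; _≤_; 1/_)
  open import Data.Rational.Properties as ℚ using ()
  open import Data.Sum using (inj₁; inj₂)
  open import Data.Vec.Functional using (_++_; concat)
  open import Data.Vec.Functional.Properties using (lookup-++ˡ; lookup-++ʳ)
  open import Function using (_∘_; flip)
  open import Function.Bundles using (mk⇔; Inverse)
  open import Function.Definitions using (Injective)
  open import Relation.Binary.PropositionalEquality
  open import Relation.Nullary using (yes; no; does)
  open import Relation.Nullary.Decidable using (⌊_⌋; _×-dec_; T?; dec-true; dec-false)

  open import Algebra.Bundles using (CommutativeMonoid; Ring)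
  import Algebra.Properties.CommutativeSemigroup
    (CommutativeMonoid.commutativeSemigroup ℚ.*-1-commutativeMonoid) as *-CommSemigroup
  import Algebra.Properties.Group ℚ.+-0-group as +-Group
  import Algebra.Properties.Semiring.Sum (Ring.semiring ℚ.+-*-ring) as Sum

  ∑≡sum : ∀ {n} (f : Fin n → ℚ) → ∑ f ≡ Sum.sum f
  ∑≡sum {zero}  f = refl
  ∑≡sum {suc n} f = cong (f zero +_) (∑≡sum (f ∘ suc))

  ∑-cong : ∀ {n} {f g : Fin n → ℚ} → (∀ i → f i ≡ g i) → ∑ f ≡ ∑ g
  ∑-cong {f = f} {g} f≗g = trans (∑≡sum f) (trans (Sum.sum-cong-≗ f≗g) (sym (∑≡sum g)))

  ∑-zero : ∀ n → ∑ {n} (λ _ → 0ℚ) ≡ 0ℚ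
  ∑-zero n = trans (∑≡sum {n} (λ _ → 0ℚ)) (Sum.sum-replicate-zero n)

  ∑-distrib-+ : ∀ {n} (f g : Fin n → ℚ) → ∑ (λ i → f i + g i) ≡ ∑ f + ∑ g
  ∑-distrib-+ f g = begin
    ∑ (λ i → f i + g i)       ≡⟨ ∑≡sum (λ i → f i + g i) ⟩
    Sum.sum (λ i → f i + g i) ≡⟨ Sum.∑-distrib-+ f g ⟩
    Sum.sum f + Sum.sum g     ≡⟨ cong₂ _+_ (∑≡sum f) (∑≡sum g) ⟨
    ∑ f + ∑ g                 ∎
    where open ≡-Reasoning

  ∑-comm : ∀ {m n} (f : Fin m → Fin n → ℚ) → ∑ (λ i → ∑ (f i)) ≡ ∑ (λ j → ∑ (λ i → f i j))
  ∑-comm f = begin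
    ∑ (λ i → ∑ (f i))                     ≡⟨ ∑∑≡sum-sum f ⟩
    Sum.sum (λ i → Sum.sum (f i))         ≡⟨ Sum.∑-comm f ⟩
    Sum.sum (λ j → Sum.sum (λ i → f i j)) ≡⟨ ∑∑≡sum-sum (λ j i → f i j) ⟨
    ∑ (λ j → ∑ (λ i → f i j))             ∎
    where
    open ≡-Reasoning
    ∑∑≡sum-sum : ∀ {m n} (g : Fin m → Fin n → ℚ) →
                 ∑ (λ i → ∑ (g i)) ≡ Sum.sum (λ i → Sum.sum (g i))
    ∑∑≡sum-sum g = trans (∑≡sum (λ i → ∑ (g i))) (Sum.sum-cong-≗ (λ i → ∑≡sum (g i)))

  *-distribˡ-∑ : ∀ {n} c (f : Fin n → ℚ) → c * ∑ f ≡ ∑ (λ i → c * f i)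
  *-distribˡ-∑ c f =
    trans (cong (c *_) (∑≡sum f)) (trans (Sum.*-distribˡ-sum c f) (sym (∑≡sum (λ i → c * f i))))

  *-distribʳ-∑ : ∀ {n} c (f : Fin n → ℚ) → ∑ f * c ≡ ∑ (λ i → f i * c)
  *-distribʳ-∑ c f =
    trans (cong (_* c) (∑≡sum f)) (trans (Sum.*-distribʳ-sum c f) (sym (∑≡sum (λ i → f i * c))))

  ∑-neg : ∀ {n} (f : Fin n → ℚ) → ∑ (λ i → - f i) ≡ - ∑ f
  ∑-neg {zero}  f = refl
  ∑-neg {suc n} f = trans (cong (- f zero +_) (∑-neg (f ∘ suc))) (sym (ℚ.neg-distrib-+ (f zero) _))

  ∑-++ : ∀ m {n} (f : Fin (m ℕ.+ n) → ℚ) →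
         ∑ f ≡ ∑ {m} (λ i → f (i ↑ˡ n)) + ∑ {n} (λ j → f (m ↑ʳ j))
  ∑-++ zero    f = sym (ℚ.+-identityˡ _)
  ∑-++ (suc m) f = trans (cong (f zero +_) (∑-++ m (f ∘ suc))) (sym (ℚ.+-assoc (f zero) _ _))

  ∑-combine : ∀ m {n} (f : Fin (m ℕ.* n) → ℚ) →
              ∑ f ≡ ∑ {m} (λ i → ∑ {n} (λ j → f (combine i j)))
  ∑-combine zero        f = refl
  ∑-combine (suc m) {n} f =
    trans (∑-++ n f) (cong (∑ (λ j → f (j ↑ˡ (m ℕ.* n))) +_) (∑-combine m (f ∘ (n ↑ʳ_))))

  ∑-nonneg : ∀ {n} {f : Fin n → ℚ} → (∀ i → 0ℚ ≤ f i) → 0ℚ ≤ ∑ f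
  ∑-nonneg {zero}  0≤f = ℚ.≤-refl
  ∑-nonneg {suc n} 0≤f = ℚ.+-mono-≤ (0≤f zero) (∑-nonneg (0≤f ∘ suc))

  term≤∑ : ∀ {n} {f : Fin n → ℚ} → (∀ i → 0ℚ ≤ f i) → ∀ a → f a ≤ ∑ f
  term≤∑ {f = f} 0≤f zero =
    subst (_≤ ∑ f) (ℚ.+-identityʳ (f zero)) (ℚ.+-monoʳ-≤ (f zero) (∑-nonneg (0≤f ∘ suc)))
  term≤∑ {f = f} 0≤f (suc a) =
    ℚ.≤-trans (term≤∑ (0≤f ∘ suc) a)
              (subst (_≤ ∑ f) (ℚ.+-identityˡ _) (ℚ.+-monoˡ-≤ _ (0≤f zero)))

  ∑≡0⇒term≡0 : ∀ {n} {f : Fin n → ℚ} → (∀ i → 0ℚ ≤ f i) → ∑ f ≡ 0ℚ → ∀ a → f a ≡ 0ℚ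
  ∑≡0⇒term≡0 0≤f ∑f≡0 a = ℚ.≤-antisym (subst (_ ≤_) ∑f≡0 (term≤∑ 0≤f a)) (0≤f a)

  when : Bool → ℚ → ℚ
  when true  q = q
  when false q = 0ℚ

  𝟙 : Bool → ℚ
  𝟙 c = when c 1ℚ

  when-nonneg : ∀ c {q} → 0ℚ ≤ q → 0ℚ ≤ when c q
  when-nonneg true  0≤q = 0≤q
  when-nonneg false _   = ℚ.≤-refl

  when-0 : ∀ c → when c 0ℚ ≡ 0ℚ
  when-0 true  = refl
  when-0 false = refl

  when-comm : ∀ c d q → when c (when d q) ≡ when d (when c q)
  when-comm true  d q = refl
  when-comm false d q = sym (when-0 d)

  when-∧ : ∀ c d q → when (c ∧ d) q ≡ when c (when d q)
  when-∧ true  d q = refl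
  when-∧ false d q = refl

  when-*ˡ : ∀ c q r → when c q * r ≡ when c (q * r)
  when-*ˡ true  q r = refl
  when-*ˡ false q r = ℚ.*-zeroˡ r

  when-*ʳ : ∀ c q r → q * when c r ≡ when c (q * r)
  when-*ʳ c q r = trans (ℚ.*-comm q (when c r)) (trans (when-*ˡ c r q) (cong (when c) (ℚ.*-comm r q)))

  𝟙-* : ∀ c q → 𝟙 c * q ≡ when c q
  𝟙-* c q = trans (when-*ˡ c 1ℚ q) (cong (when c) (ℚ.*-identityˡ q))

  when-∑ : ∀ c {n} (f : Fin n → ℚ) → when c (∑ f) ≡ ∑ (λ i → when c (f i))
  when-∑ true      f = refl
  when-∑ false {n} f = sym (∑-zero n)

  when-≟-subst : ∀ {m} (a s : Fin m) (f : Fin m → ℚ) → when ⌊ a ≟ s ⌋ (f a) ≡ when ⌊ a ≟ s ⌋ (f s)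
  when-≟-subst a s f with a ≟ s
  ... | yes refl = refl
  ... | no  _    = refl

  when-≟-refl : ∀ {m} (a : Fin m) q → when ⌊ a ≟ a ⌋ q ≡ q
  when-≟-refl a q with a ≟ a
  ... | yes _   = refl
  ... | no  a≢a = ⊥-elim (a≢a refl)

  ≟-suc : ∀ {n} (a t : Fin n) → ⌊ suc a ≟ suc t ⌋ ≡ ⌊ a ≟ t ⌋
  ≟-suc a t with a ≟ t
  ... | yes _ = refl
  ... | no  _ = refl

  ∑-when-≟ : ∀ {n} (a : Fin n) (f : Fin n → ℚ) → ∑ (λ t → when ⌊ a ≟ t ⌋ (f t)) ≡ f a
  ∑-when-≟ {suc n} zero f = trans (cong (f zero +_) (∑-zero n)) (ℚ.+-identityʳ (f zero))
  ∑-when-≟ (suc a) f = begin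
    0ℚ + ∑ (λ t → when ⌊ suc a ≟ suc t ⌋ (f (suc t)))
      ≡⟨ ℚ.+-identityˡ _ ⟩
    ∑ (λ t → when ⌊ suc a ≟ suc t ⌋ (f (suc t)))
      ≡⟨ ∑-cong (λ t → cong (λ c → when c (f (suc t))) (≟-suc a t)) ⟩
    ∑ (λ t → when ⌊ a ≟ t ⌋ (f (suc t)))
      ≡⟨ ∑-when-≟ a (f ∘ suc) ⟩
    f (suc a) ∎
    where open ≡-Reasoning

  ∑-fibres : ∀ {m n} (φ : Fin m → Fin n) (f : Fin m → ℚ) →
             ∑ f ≡ ∑ (λ t → ∑ (λ i → when ⌊ φ i ≟ t ⌋ (f i)))
  ∑-fibres φ f =
    trans (∑-cong (λ i → sym (∑-when-≟ (φ i) (λ _ → f i))))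
          (∑-comm (λ i t → when ⌊ φ i ≟ t ⌋ (f i)))

  infix 7 _·_

  _·_ : ∀ {n} → (Fin n → ℚ) → (Fin n → ℚ) → ℚ
  a · y = ∑ (λ j → a j * y j)

  ·-++ : ∀ {m n} (a : Fin m → ℚ) (a′ : Fin n → ℚ) y →
         (a ++ a′) · y ≡ a · (λ i → y (i ↑ˡ n)) + a′ · (λ j → y (m ↑ʳ j))
  ·-++ {m} a a′ y = trans (∑-++ m _) (cong₂ _+_
    (∑-cong (λ i → cong (_* y (i ↑ˡ _)) (lookup-++ˡ a a′ i)))
    (∑-cong (λ j → cong (_* y (m ↑ʳ j)) (lookup-++ʳ a a′ j))))

  concat-combine : ∀ {A : Set} {m n} (xs : Fin m → Fin n → A) s i → concat xs (combine s i) ≡ xs s i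
  concat-combine xs s i = cong (uncurry (flip xs) ∘ swap) (remQuot-combine s i)

  ·-concat : ∀ {m n} (xs : Fin m → Fin n → ℚ) y →
             concat xs · y ≡ ∑ (λ s → xs s · (λ i → y (combine s i)))
  ·-concat {m} xs y = trans (∑-combine m _)
    (∑-cong (λ s → ∑-cong (λ i → cong (_* y (combine s i)) (concat-combine xs s i))))

  ·-𝟙 : ∀ {n} (p : Fin n → Bool) z → (λ i → 𝟙 (p i)) · z ≡ ∑ (λ i → when (p i) (z i))
  ·-𝟙 p z = ∑-cong (λ i → 𝟙-* (p i) (z i))

  ·-when : ∀ {n} c (a z : Fin n → ℚ) → (λ i → when c (a i)) · z ≡ when c (a · z)
  ·-when c a z = trans (∑-cong (λ i → when-*ˡ c (a i) (z i))) (sym (when-∑ c (λ i → a i * z i)))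

  ·-neg : ∀ {n} (a z : Fin n → ℚ) → (λ i → - a i) · z ≡ - (a · z)
  ·-neg a z = trans (∑-cong (λ i → sym (ℚ.neg-distribˡ-* (a i) (z i)))) (∑-neg (λ i → a i * z i))

  ·-zero : ∀ {n} (z : Fin n → ℚ) → (λ _ → 0ℚ) · z ≡ 0ℚ
  ·-zero {n} z = trans (∑-cong (λ i → ℚ.*-zeroˡ (z i))) (∑-zero n)

  ·-one : ∀ {n} (z : Fin n → ℚ) → (λ _ → 1ℚ) · z ≡ ∑ z
  ·-one z = ∑-cong (λ i → ℚ.*-identityˡ (z i))

  unit-· : ∀ {n} (v : Fin n) z → (λ i → 𝟙 ⌊ v ≟ i ⌋) · z ≡ z v
  unit-· v z = trans (·-𝟙 (λ i → ⌊ v ≟ i ⌋) z) (∑-when-≟ v z)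

  ∑-·-when-≟ : ∀ {m n} (s : Fin m) (a : Fin n → ℚ) (z : Fin m → Fin n → ℚ) →
               ∑ (λ s′ → (λ i → when ⌊ s ≟ s′ ⌋ (a i)) · z s′) ≡ a · z s
  ∑-·-when-≟ s a z =
    trans (∑-cong (λ s′ → ·-when ⌊ s ≟ s′ ⌋ a (z s′))) (∑-when-≟ s (λ s′ → a · z s′))

  0≤* : ∀ {p q} → 0ℚ ≤ p → 0ℚ ≤ q → 0ℚ ≤ p * q
  0≤* {p} {q} 0≤p 0≤q = ℚ.nonNegative⁻¹ (p * q)
    {{ℚ.nonNeg*nonNeg⇒nonNeg p {{ℚ.nonNegative 0≤p}} q {{ℚ.nonNegative 0≤q}}}}

  -q≤0⇒0≤q : ∀ {q} → - q ≤ 0ℚ → 0ℚ ≤ q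
  -q≤0⇒0≤q {q} -q≤0 = subst (0ℚ ≤_) (+-Group.⁻¹-involutive q) (ℚ.neg-antimono-≤ -q≤0)

  -- A total inverse, with junk value inv 0ℚ = 0ℚ.
  inv : ℚ → ℚ
  inv q with q ℚ.≟ 0ℚ
  ... | yes _   = 0ℚ
  ... | no q≢0 = (1/ q) {{ℚ.≢-nonZero q≢0}}

  inv-nonneg : ∀ {q} → 0ℚ ≤ q → 0ℚ ≤ inv q
  inv-nonneg {q} 0≤q with q ℚ.≟ 0ℚ
  ... | yes _   = ℚ.≤-refl
  ... | no q≢0 = ℚ.<⇒≤ (ℚ.positive⁻¹ (1/ q))
    where instance
      _ = ℚ.≢-nonZero q≢0
      _ = ℚ.nonNegative 0≤q
      _ = ℚ.nonNeg∧nonZero⇒pos q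
      _ = ℚ.1/pos⇒pos q

  *-inv-cancel : ∀ a r → (r ≡ 0ℚ → a ≡ 0ℚ) → a * (r * inv r) ≡ a
  *-inv-cancel a r r≡0⇒a≡0 with r ℚ.≟ 0ℚ
  ... | yes r≡0 = trans (cong (a *_) (ℚ.*-zeroʳ r)) (trans (ℚ.*-zeroʳ a) (sym (r≡0⇒a≡0 r≡0)))
  ... | no r≢0 = trans (cong (a *_) (ℚ.*-inverseʳ r {{ℚ.≢-nonZero r≢0}})) (ℚ.*-identityʳ a)

  χ-split : ∀ {n} (c : Fin n → Fin n → ℚ) → (∀ v → c v v ≡ 0ℚ) →
            ∀ i j v → c i j * χ i j v ≡ when ⌊ v ≟ i ⌋ (c i j) + when ⌊ v ≟ j ⌋ (c i j)
  χ-split c c-diag i j v with v ≟ i | v ≟ j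
  ... | yes refl | yes refl =
    trans (ℚ.*-identityʳ (c v v)) (trans (c-diag v) (sym (cong₂ _+_ (c-diag v) (c-diag v))))
  ... | yes refl | no _     = trans (ℚ.*-identityʳ (c v j)) (sym (ℚ.+-identityʳ (c v j)))
  ... | no _     | yes refl = trans (ℚ.*-identityʳ (c i v)) (sym (ℚ.+-identityˡ (c i v)))
  ... | no _     | no _     = ℚ.*-zeroʳ (c i j)

  ∑∑-χ : ∀ {n} (c : Fin n → Fin n → ℚ) → (∀ v → c v v ≡ 0ℚ) →
         ∀ v → ∑ (λ i → ∑ (λ j → c i j * χ i j v)) ≡ ∑ (c v) + ∑ (λ i → c i v)
  ∑∑-χ {n} c c-diag v = begin
    ∑ (λ i → ∑ (λ j → c i j * χ i j v))
      ≡⟨ ∑-cong (λ i → trans (∑-cong (λ j → χ-split c c-diag i j v)) (∑-distrib-+ (left i) (right i))) ⟩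
    ∑ (λ i → ∑ (left i) + ∑ (right i))
      ≡⟨ ∑-distrib-+ (∑ ∘ left) (∑ ∘ right) ⟩
    ∑ (λ i → ∑ (left i)) + ∑ (λ i → ∑ (right i))
      ≡⟨ cong₂ _+_ (trans (∑-cong (λ i → sym (when-∑ ⌊ v ≟ i ⌋ (c i)))) (∑-when-≟ v (∑ ∘ c)))
                   (∑-cong (λ i → ∑-when-≟ v (c i))) ⟩
    ∑ (c v) + ∑ (λ i → c i v) ∎
    where
    open ≡-Reasoning
    left right : Fin n → Fin n → ℚ
    left  i j = when ⌊ v ≟ i ⌋ (c i j)
    right i j = when ⌊ v ≟ j ⌋ (c i j)

  -- For each (s, t), {i : label i s ≡ t} × {j : block j ≡ s, accepts t j} is a biclique of G, and every
  -- ordered edge (i, j) lies in exactly one of them, namely the one with s = block j, t = label i s.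
  record Factorisation {n} (G : Graph n) (b K : ℕ) : Set where
    field
      block       : Fin n → Fin b
      label       : Fin n → Fin b → Fin K
      accepts     : Fin K → Fin n → Bool
      adj-factors : ∀ i j → Graph.Adj G i j ≡ accepts (label i (block j)) j

  module FactorisationExtension {n b K} {G : Graph n} (F : Factorisation G b K) where

    open Factorisation F
    open Graph G using (Adj; irrefl)

    leftLoad : (Fin b → Fin n → ℚ) → Fin b → Fin K → ℚ
    leftLoad out s t = ∑ (λ i → when ⌊ label i s ≟ t ⌋ (out s i))

    rightLoad : (Fin K → Fin n → ℚ) → Fin b → Fin K → ℚ
    rightLoad into s t = ∑ (λ j → when (⌊ block j ≟ s ⌋ ∧ accepts t j) (into t j))

    record Flow (x : Fin n → ℚ) : Set where
      field
        out      : Fin b → Fin n → ℚ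
        into     : Fin K → Fin n → ℚ
        out≥0    : ∀ s i → 0ℚ ≤ out s i
        into≥0   : ∀ t j → 0ℚ ≤ into t j
        balanced : ∀ s t → leftLoad out s t ≡ rightLoad into s t
        total    : ∑ (λ s → ∑ (out s)) ≡ 1ℚ
        marginal : ∀ v → x v ≡ ∑ (λ s → out s v) + ∑ (λ t → when (accepts t v) (into t v))

    module EdgeWeights (c : Fin n → Fin n → ℚ) (c-edges : ∀ i j → Adj i j ≡ false → c i j ≡ 0ℚ) where

      on-edges : ∀ i j → when (accepts (label i (block j)) j) (c i j) ≡ c i j
      on-edges i j rewrite sym (adj-factors i j) with Adj i j in eq
      ... | true  = refl
      ... | false = sym (c-edges i j eq)

      out : Fin b → Fin n → ℚ
      out s i = ∑ (λ j → when ⌊ block j ≟ s ⌋ (c i j))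

      into : Fin K → Fin n → ℚ
      into t j = ∑ (λ i → when ⌊ label i (block j) ≟ t ⌋ (c i j))

      ∑-out : ∀ i → ∑ (λ s → out s i) ≡ ∑ (c i)
      ∑-out i = sym (∑-fibres block (c i))

      ∑-into : ∀ v → ∑ (λ t → when (accepts t v) (into t v)) ≡ ∑ (λ i → c i v)
      ∑-into v = begin
        ∑ (λ t → when (accepts t v) (∑ (λ i → from t i)))
          ≡⟨ ∑-cong (λ t → when-∑ (accepts t v) (from t)) ⟩
        ∑ (λ t → ∑ (λ i → when (accepts t v) (from t i)))
          ≡⟨ ∑-comm (λ t i → when (accepts t v) (from t i)) ⟩
        ∑ (λ i → ∑ (λ t → when (accepts t v) (from t i)))
          ≡⟨ ∑-cong (λ i → trans (∑-cong (λ t → when-comm (accepts t v) ⌊ label i (block v) ≟ t ⌋ (c i v)))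
                                  (∑-when-≟ (label i (block v)) (λ t → when (accepts t v) (c i v)))) ⟩
        ∑ (λ i → when (accepts (label i (block v)) v) (c i v))
          ≡⟨ ∑-cong (λ i → on-edges i v) ⟩
        ∑ (λ i → c i v) ∎
        where
        open ≡-Reasoning
        from : Fin K → Fin n → ℚ
        from t i = when ⌊ label i (block v) ≟ t ⌋ (c i v)

      balance-term : ∀ s t i j →
        when (⌊ block j ≟ s ⌋ ∧ accepts t j) (when ⌊ label i (block j) ≟ t ⌋ (c i j))
          ≡ when ⌊ label i s ≟ t ⌋ (when ⌊ block j ≟ s ⌋ (c i j))
      balance-term s t i j with block j ≟ s
      ... | no _ = sym (when-0 ⌊ label i s ≟ t ⌋)
      ... | yes refl with label i (block j) ≟ t
      ...   | no _     = when-0 (accepts t j)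
      ...   | yes refl = on-edges i j

      balanced : ∀ s t → leftLoad out s t ≡ rightLoad into s t
      balanced s t = begin
        ∑ (λ i → when ⌊ label i s ≟ t ⌋ (∑ (λ j → when ⌊ block j ≟ s ⌋ (c i j))))
          ≡⟨ ∑-cong (λ i → when-∑ ⌊ label i s ≟ t ⌋ (λ j → when ⌊ block j ≟ s ⌋ (c i j))) ⟩
        ∑ (λ i → ∑ (λ j → term i j))
          ≡⟨ ∑-comm term ⟩
        ∑ (λ j → ∑ (λ i → term i j))
          ≡⟨ ∑-cong (λ j → trans (when-∑ (right j) (into-term j)) (∑-cong (λ i → balance-term s t i j))) ⟨
        ∑ (λ j → when (right j) (∑ (into-term j))) ∎
        where
        open ≡-Reasoning
        term into-term : Fin n → Fin n → ℚ
        term i j = when ⌊ label i s ≟ t ⌋ (when ⌊ block j ≟ s ⌋ (c i j))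
        into-term j i = when ⌊ label i (block j) ≟ t ⌋ (c i j)
        right : Fin n → Bool
        right j = ⌊ block j ≟ s ⌋ ∧ accepts t j

    edgePolytope⇒flow : ∀ {x} → InEdgePolytope G x → Flow x
    edgePolytope⇒flow (c , 0≤c , c-edges , c-total , x≡) = record
      { out      = out
      ; into     = into
      ; out≥0    = λ s i → ∑-nonneg (λ j → when-nonneg ⌊ block j ≟ s ⌋ (0≤c i j))
      ; into≥0   = λ t j → ∑-nonneg (λ i → when-nonneg ⌊ label i (block j) ≟ t ⌋ (0≤c i j))
      ; balanced = balanced
      ; total    = trans (∑-comm out) (trans (∑-cong ∑-out) c-total)
      ; marginal = λ v → trans (x≡ v) (trans (∑∑-χ c (λ u → c-edges u u (irrefl u)) v)
                                             (sym (cong₂ _+_ (∑-out v) (∑-into v))))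
      }
      where open EdgeWeights c c-edges

    module FlowWeights {x} (φ : Flow x) where

      open Flow φ

      -- Biclique (s, t) spreads the weight out s i of its left vertex i over its right vertices j
      -- in proportion to into t j.
      share : Fin b → Fin K → Fin n → ℚ
      share s t j = when (accepts t j) (into t j) * inv (rightLoad into s t)

      c : Fin n → Fin n → ℚ
      c i j = out (block j) i * share (block j) (label i (block j)) j

      0≤rightLoad : ∀ s t → 0ℚ ≤ rightLoad into s t
      0≤rightLoad s t = ∑-nonneg (λ j → when-nonneg (⌊ block j ≟ s ⌋ ∧ accepts t j) (into≥0 t j))

      0≤c : ∀ i j → 0ℚ ≤ c i j
      0≤c i j = 0≤* (out≥0 s i) (0≤* (when-nonneg (accepts t j) (into≥0 t j)) (inv-nonneg (0≤rightLoad s t)))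
        where
        s : Fin b
        s = block j
        t : Fin K
        t = label i s

      c-edges : ∀ i j → Adj i j ≡ false → c i j ≡ 0ℚ
      c-edges i j adj≡false rewrite trans (sym (adj-factors i j)) adj≡false =
        trans (cong (out (block j) i *_) (ℚ.*-zeroˡ (inv (rightLoad into (block j) (label i (block j))))))
              (ℚ.*-zeroʳ (out (block j) i))

      rightLoad≡0⇒out≡0 : ∀ s i → rightLoad into s (label i s) ≡ 0ℚ → out s i ≡ 0ℚ
      rightLoad≡0⇒out≡0 s i R≡0 = trans (sym (when-≟-refl t (out s i)))
        (∑≡0⇒term≡0 (λ i′ → when-nonneg ⌊ label i′ s ≟ t ⌋ (out≥0 s i′)) (trans (balanced s t) R≡0) i)
        where
        t : Fin K
        t = label i s

      rightLoad≡0⇒into≡0 : ∀ t v → rightLoad into (block v) t ≡ 0ℚ → when (accepts t v) (into t v) ≡ 0ℚ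
      rightLoad≡0⇒into≡0 t v R≡0 = begin
        when (accepts t v) (into t v)
          ≡⟨ when-≟-refl s (when (accepts t v) (into t v)) ⟨
        when ⌊ s ≟ s ⌋ (when (accepts t v) (into t v))
          ≡⟨ when-∧ ⌊ s ≟ s ⌋ (accepts t v) (into t v) ⟨
        when (⌊ s ≟ s ⌋ ∧ accepts t v) (into t v)
          ≡⟨ ∑≡0⇒term≡0 (λ j → when-nonneg (⌊ block j ≟ s ⌋ ∧ accepts t j) (into≥0 t j)) R≡0 v ⟩
        0ℚ ∎
        where
        open ≡-Reasoning
        s : Fin b
        s = block v

      ∑-share : ∀ s t →
        ∑ (λ j → when ⌊ block j ≟ s ⌋ (share s t j)) ≡ rightLoad into s t * inv (rightLoad into s t)
      ∑-share s t = begin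
        ∑ (λ j → when ⌊ block j ≟ s ⌋ (when (accepts t j) (into t j) * inv R))
          ≡⟨ ∑-cong (λ j → trans (sym (when-*ˡ ⌊ block j ≟ s ⌋ (when (accepts t j) (into t j)) (inv R)))
                                (cong (_* inv R) (sym (when-∧ ⌊ block j ≟ s ⌋ (accepts t j) (into t j))))) ⟩
        ∑ (λ j → when (⌊ block j ≟ s ⌋ ∧ accepts t j) (into t j) * inv R)
          ≡⟨ *-distribʳ-∑ (inv R) (λ j → when (⌊ block j ≟ s ⌋ ∧ accepts t j) (into t j)) ⟨
        R * inv R ∎
        where
        open ≡-Reasoning
        R : ℚ
        R = rightLoad into s t

      ∑-row : ∀ i → ∑ (c i) ≡ ∑ (λ s → out s i)
      ∑-row i = trans (∑-fibres block (c i)) (∑-cong block-part)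
        where
        block-part : ∀ s → ∑ (λ j → when ⌊ block j ≟ s ⌋ (c i j)) ≡ out s i
        block-part s = begin
          ∑ (λ j → when ⌊ block j ≟ s ⌋ (c i j))
            ≡⟨ ∑-cong (λ j → when-≟-subst (block j) s (λ s′ → out s′ i * share s′ (label i s′) j)) ⟩
          ∑ (λ j → when ⌊ block j ≟ s ⌋ (out s i * share s t j))
            ≡⟨ ∑-cong (λ j → when-*ʳ ⌊ block j ≟ s ⌋ (out s i) (share s t j)) ⟨
          ∑ (λ j → out s i * when ⌊ block j ≟ s ⌋ (share s t j))
            ≡⟨ *-distribˡ-∑ (out s i) (λ j → when ⌊ block j ≟ s ⌋ (share s t j)) ⟨
          out s i * ∑ (λ j → when ⌊ block j ≟ s ⌋ (share s t j))
            ≡⟨ cong (out s i *_) (∑-share s t) ⟩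
          out s i * (rightLoad into s t * inv (rightLoad into s t))
            ≡⟨ *-inv-cancel (out s i) (rightLoad into s t) (rightLoad≡0⇒out≡0 s i) ⟩
          out s i ∎
          where
          open ≡-Reasoning
          t : Fin K
          t = label i s

      ∑-col : ∀ v → ∑ (λ i → c i v) ≡ ∑ (λ t → when (accepts t v) (into t v))
      ∑-col v = trans (∑-fibres (λ i → label i s) (λ i → c i v)) (∑-cong label-part)
        where
        s : Fin b
        s = block v
        label-part : ∀ t → ∑ (λ i → when ⌊ label i s ≟ t ⌋ (c i v)) ≡ when (accepts t v) (into t v)
        label-part t = begin
          ∑ (λ i → when ⌊ label i s ≟ t ⌋ (out s i * share s (label i s) v))
            ≡⟨ ∑-cong (λ i → when-≟-subst (label i s) t (λ t′ → out s i * share s t′ v)) ⟩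
          ∑ (λ i → when ⌊ label i s ≟ t ⌋ (out s i * share s t v))
            ≡⟨ ∑-cong (λ i → when-*ˡ ⌊ label i s ≟ t ⌋ (out s i) (share s t v)) ⟨
          ∑ (λ i → when ⌊ label i s ≟ t ⌋ (out s i) * share s t v)
            ≡⟨ *-distribʳ-∑ (share s t v) (λ i → when ⌊ label i s ≟ t ⌋ (out s i)) ⟨
          leftLoad out s t * share s t v
            ≡⟨ cong (_* share s t v) (balanced s t) ⟩
          R * (q * inv R)
            ≡⟨ *-CommSemigroup.x∙yz≈y∙xz R q (inv R) ⟩
          q * (R * inv R)
            ≡⟨ *-inv-cancel q R (rightLoad≡0⇒into≡0 t v) ⟩
          q ∎
          where
          open ≡-Reasoning
          R : ℚ
          R = rightLoad into s t
          q : ℚ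
          q = when (accepts t v) (into t v)

    flow⇒edgePolytope : ∀ {x} → Flow x → InEdgePolytope G x
    flow⇒edgePolytope {x} φ = c , 0≤c , c-edges , c-total , x≡
      where
      open Flow φ
      open FlowWeights φ
      c-total : ∑ (λ i → ∑ (c i)) ≡ 1ℚ
      c-total = trans (∑-cong ∑-row) (trans (∑-comm (λ i s → out s i)) total)
      x≡ : ∀ v → x v ≡ ∑ (λ i → ∑ (λ j → c i j * χ i j v))
      x≡ v = trans (marginal v) (trans (sym (cong₂ _+_ (∑-row v) (∑-col v)))
                                       (sym (∑∑-χ c (λ u → c-edges u u (irrefl u)) v)))

    e : ℕ
    e = b ℕ.* n ℕ.+ K ℕ.* n

    vars : (Fin b → Fin n → ℚ) → (Fin K → Fin n → ℚ) → Fin e → ℚ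
    vars U W = concat U ++ concat W

    outPart : (Fin e → ℚ) → Fin b → Fin n → ℚ
    outPart y s i = y (combine s i ↑ˡ K ℕ.* n)

    intoPart : (Fin e → ℚ) → Fin K → Fin n → ℚ
    intoPart y t j = y (b ℕ.* n ↑ʳ combine t j)

    outPart-vars : ∀ U W s i → outPart (vars U W) s i ≡ U s i
    outPart-vars U W s i = trans (lookup-++ˡ (concat U) (concat W) (combine s i)) (concat-combine U s i)

    intoPart-vars : ∀ U W t j → intoPart (vars U W) t j ≡ W t j
    intoPart-vars U W t j = trans (lookup-++ʳ (concat U) (concat W) (combine t j)) (concat-combine W t j)

    ·-vars : ∀ U W y → vars U W · y ≡ ∑ (λ s → U s · outPart y s) + ∑ (λ t → W t · intoPart y t)
    ·-vars U W y = trans (·-++ (concat U) (concat W) y)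
      (cong₂ _+_ (·-concat U (λ r → y (r ↑ˡ K ℕ.* n))) (·-concat W (λ r → y (b ℕ.* n ↑ʳ r))))

    nonnegRow : Fin e → Fin e → ℚ
    nonnegRow r j = - 𝟙 ⌊ r ≟ j ⌋

    balanceRow : Fin b → Fin K → Fin e → ℚ
    balanceRow s t = vars (λ s′ i → when ⌊ s ≟ s′ ⌋ (𝟙 ⌊ label i s ≟ t ⌋))
                          (λ t′ j → when ⌊ t ≟ t′ ⌋ (- 𝟙 (⌊ block j ≟ s ⌋ ∧ accepts t j)))

    totalRow : Fin e → ℚ
    totalRow = vars (λ _ _ → 1ℚ) (λ _ _ → 0ℚ)

    marginalRow : Fin n → Fin e → ℚ
    marginalRow v = vars (λ _ i → 𝟙 ⌊ v ≟ i ⌋) (λ t j → when (accepts t v) (𝟙 ⌊ v ≟ j ⌋))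

    equationRow : Fin (b ℕ.* K ℕ.+ 1) → Fin e → ℚ
    equationRow = concat balanceRow ++ (λ _ → totalRow)

    equationRhs : Fin (b ℕ.* K ℕ.+ 1) → ℚ
    equationRhs = (λ _ → 0ℚ) ++ (λ (_ : Fin 1) → 1ℚ)

    nonnegRow-· : ∀ r y → nonnegRow r · y ≡ - y r
    nonnegRow-· r y = trans (·-neg (λ j → 𝟙 ⌊ r ≟ j ⌋) y) (cong -_ (unit-· r y))

    balanceRow-· : ∀ s t y → balanceRow s t · y ≡ leftLoad (outPart y) s t + - rightLoad (intoPart y) s t
    balanceRow-· s t y = begin
      balanceRow s t · y
        ≡⟨ ·-vars (λ s′ i → when ⌊ s ≟ s′ ⌋ (left i)) (λ t′ j → when ⌊ t ≟ t′ ⌋ (- right j)) y ⟩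
      ∑ (λ s′ → (λ i → when ⌊ s ≟ s′ ⌋ (left i)) · outPart y s′)
        + ∑ (λ t′ → (λ j → when ⌊ t ≟ t′ ⌋ (- right j)) · intoPart y t′)
        ≡⟨ cong₂ _+_ (∑-·-when-≟ s left (outPart y)) (∑-·-when-≟ t (λ j → - right j) (intoPart y)) ⟩
      left · outPart y s + (λ j → - right j) · intoPart y t
        ≡⟨ cong₂ _+_ (·-𝟙 (λ i → ⌊ label i s ≟ t ⌋) (outPart y s))
                     (trans (·-neg right (intoPart y t))
                            (cong -_ (·-𝟙 (λ j → ⌊ block j ≟ s ⌋ ∧ accepts t j) (intoPart y t)))) ⟩
      leftLoad (outPart y) s t + - rightLoad (intoPart y) s t ∎
      where
      open ≡-Reasoning
      left right : Fin n → ℚ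
      left  i = 𝟙 ⌊ label i s ≟ t ⌋
      right j = 𝟙 (⌊ block j ≟ s ⌋ ∧ accepts t j)

    totalRow-· : ∀ y → totalRow · y ≡ ∑ (λ s → ∑ (outPart y s))
    totalRow-· y = begin
      totalRow · y
        ≡⟨ ·-vars (λ _ _ → 1ℚ) (λ _ _ → 0ℚ) y ⟩
      ∑ (λ s → (λ _ → 1ℚ) · outPart y s) + ∑ (λ t → (λ _ → 0ℚ) · intoPart y t)
        ≡⟨ cong₂ _+_ (∑-cong (λ s → ·-one (outPart y s)))
                     (trans (∑-cong (λ t → ·-zero (intoPart y t))) (∑-zero K)) ⟩
      ∑ (λ s → ∑ (outPart y s)) + 0ℚ
        ≡⟨ ℚ.+-identityʳ (∑ (λ s → ∑ (outPart y s))) ⟩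
      ∑ (λ s → ∑ (outPart y s)) ∎
      where open ≡-Reasoning

    marginalRow-· : ∀ v y →
      marginalRow v · y ≡ ∑ (λ s → outPart y s v) + ∑ (λ t → when (accepts t v) (intoPart y t v))
    marginalRow-· v y = trans (·-vars (λ _ i → unit i) (λ t j → when (accepts t v) (unit j)) y) (cong₂ _+_
      (∑-cong (λ s → unit-· v (outPart y s)))
      (∑-cong (λ t → trans (·-when (accepts t v) unit (intoPart y t))
                           (cong (when (accepts t v)) (unit-· v (intoPart y t))))))
      where
      unit : Fin n → ℚ
      unit i = 𝟙 ⌊ v ≟ i ⌋

    extension : Extension n
    extension = record
      { e = e ; m = e ; k = b ℕ.* K ℕ.+ 1
      ; A = nonnegRow ; b = λ _ → 0ℚ
      ; E = equationRow ; f = equationRhs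
      ; T = marginalRow ; t = λ _ → 0ℚ
      }

    open Extension extension using (InQ; π)

    flow⇒solution : ∀ {x} → Flow x → Σ (Fin e → ℚ) λ y → InQ y × (∀ v → π y v ≡ x v)
    flow⇒solution {x} φ = y , (nonneg , equations) , π≡x
      where
      open Flow φ
      y : Fin e → ℚ
      y = vars out into

      balanced-y : ∀ s t → leftLoad (outPart y) s t ≡ rightLoad (intoPart y) s t
      balanced-y s t = begin
        leftLoad (outPart y) s t
          ≡⟨ ∑-cong (λ i → cong (when ⌊ label i s ≟ t ⌋) (outPart-vars out into s i)) ⟩
        leftLoad out s t
          ≡⟨ balanced s t ⟩
        rightLoad into s t
          ≡⟨ ∑-cong (λ j → cong (when (⌊ block j ≟ s ⌋ ∧ accepts t j)) (intoPart-vars out into t j)) ⟨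
        rightLoad (intoPart y) s t ∎
        where open ≡-Reasoning

      balance-equation : ∀ s t → balanceRow s t · y ≡ 0ℚ
      balance-equation s t = trans (balanceRow-· s t y)
        (trans (cong (_+ - rightLoad (intoPart y) s t) (balanced-y s t))
               (ℚ.+-inverseʳ (rightLoad (intoPart y) s t)))

      0≤y : ∀ r → 0ℚ ≤ y r
      0≤y r with splitAt (b ℕ.* n) r
      ... | inj₁ _ = out≥0 _ _
      ... | inj₂ _ = into≥0 _ _

      nonneg : ∀ r → nonnegRow r · y ≤ 0ℚ
      nonneg r = subst (_≤ 0ℚ) (sym (nonnegRow-· r y)) (ℚ.neg-antimono-≤ (0≤y r))

      equations : ∀ r → equationRow r · y ≡ equationRhs r
      equations r with splitAt (b ℕ.* K) r
      ... | inj₁ st = uncurry (flip balance-equation) (quotRem K st)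
      ... | inj₂ _  = trans (totalRow-· y) (trans (∑-cong (λ s → ∑-cong (outPart-vars out into s))) total)

      π≡x : ∀ v → π y v ≡ x v
      π≡x v = begin
        marginalRow v · y + 0ℚ
          ≡⟨ trans (ℚ.+-identityʳ _) (marginalRow-· v y) ⟩
        ∑ (λ s → outPart y s v) + ∑ (λ t → when (accepts t v) (intoPart y t v))
          ≡⟨ cong₂ _+_ (∑-cong (λ s → outPart-vars out into s v))
                       (∑-cong (λ t → cong (when (accepts t v)) (intoPart-vars out into t v))) ⟩
        ∑ (λ s → out s v) + ∑ (λ t → when (accepts t v) (into t v))
          ≡⟨ marginal v ⟨
        x v ∎
        where open ≡-Reasoning

    solution⇒flow : ∀ {x} y → InQ y → (∀ v → π y v ≡ x v) → Flow x
    solution⇒flow {x} y (nonneg , equations) π≡x = record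
      { out      = outPart y
      ; into     = intoPart y
      ; out≥0    = λ s i → 0≤y (combine s i ↑ˡ K ℕ.* n)
      ; into≥0   = λ t j → 0≤y (b ℕ.* n ↑ʳ combine t j)
      ; balanced = balanced
      ; total    = total
      ; marginal = λ v → trans (sym (π≡x v)) (trans (ℚ.+-identityʳ _) (marginalRow-· v y))
      }
      where
      0≤y : ∀ r → 0ℚ ≤ y r
      0≤y r = -q≤0⇒0≤q (subst (_≤ 0ℚ) (nonnegRow-· r y) (nonneg r))

      balanced : ∀ s t → leftLoad (outPart y) s t ≡ rightLoad (intoPart y) s t
      balanced s t = +-Group.x∙y⁻¹≈ε⇒x≈y _ _ (begin
        leftLoad (outPart y) s t + - rightLoad (intoPart y) s t
          ≡⟨ balanceRow-· s t y ⟨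
        balanceRow s t · y
          ≡⟨ cong (_· y) (trans (lookup-++ˡ (concat balanceRow) (λ _ → totalRow) (combine s t))
                                (concat-combine balanceRow s t)) ⟨
        equationRow (combine s t ↑ˡ 1) · y
          ≡⟨ equations (combine s t ↑ˡ 1) ⟩
        equationRhs (combine s t ↑ˡ 1)
          ≡⟨ lookup-++ˡ (λ _ → 0ℚ) (λ (_ : Fin 1) → 1ℚ) (combine s t) ⟩
        0ℚ ∎)
        where open ≡-Reasoning

      total : ∑ (λ s → ∑ (outPart y s)) ≡ 1ℚ
      total = begin
        ∑ (λ s → ∑ (outPart y s))         ≡⟨ totalRow-· y ⟨
        totalRow · y                      ≡⟨ cong (_· y) (lookup-++ʳ (concat balanceRow) (λ _ → totalRow) zero) ⟨
        equationRow (b ℕ.* K ↑ʳ zero) · y ≡⟨ equations (b ℕ.* K ↑ʳ zero) ⟩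
        equationRhs (b ℕ.* K ↑ʳ zero)     ≡⟨ lookup-++ʳ (λ (_ : Fin (b ℕ.* K)) → 0ℚ) (λ _ → 1ℚ) zero ⟩
        1ℚ                                ∎
        where open ≡-Reasoning

    isExtension : IsExtensionOf extension (InEdgePolytope G)
    isExtension x = mk⇔
      (flow⇒solution ∘ edgePolytope⇒flow)
      (λ (y , y∈Q , π≡x) → flow⇒edgePolytope (solution⇒flow y y∈Q π≡x))

  extend : ∀ {m n} → (Fin m → Fin n) → (Fin m → Bool) → Fin n → Bool
  extend ι p y = does (any? (λ i → ι i ≟ y ×-dec T? (p i)))

  extend-∘ : ∀ {m n} {ι : Fin m → Fin n} → Injective _≡_ _≡_ ι → ∀ p i → extend ι p (ι i) ≡ p i
  extend-∘ {ι = ι} ι-injective p i with p i in pi≡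
  ... | true  = dec-true (any? (λ j → ι j ≟ ι i ×-dec T? (p j))) (i , refl , subst T (sym pi≡) _)
  ... | false = dec-false (any? (λ j → ι j ≟ ι i ×-dec T? (p j)))
                          (λ (j , ιj≡ιi , T-pj) → subst T (trans (cong p (ι-injective ιj≡ιi)) pi≡) T-pj)

  -- Vertex j occupies the cell (block j, offset j) of a b × k grid, and the label of i with respect
  -- to a block is the k-bit word recording which cells of that block hold neighbours of i.
  blockFactorisation : ∀ {n} (G : Graph n) k b → n ℕ.≤ b ℕ.* k → Factorisation G b (2 ℕ.^ k)
  blockFactorisation {n} G k b n≤bk = record
    { block = block ; label = label ; accepts = accepts ; adj-factors = adj-factors }
    where
    open Graph G using (Adj)
    open Inverse 2↔Bool using () renaming (to to toBool; from to fromBool; strictlyInverseˡ to toBool∘fromBool)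

    slot : Fin n → Fin (b ℕ.* k)
    slot j = inject≤ j n≤bk

    block : Fin n → Fin b
    block j = proj₁ (remQuot {b} k (slot j))

    offset : Fin n → Fin k
    offset j = proj₂ (remQuot {b} k (slot j))

    neighbourhood : Fin n → Fin b → Fin k → Fin 2
    neighbourhood i s p = fromBool (extend slot (Adj i) (combine s p))

    label : Fin n → Fin b → Fin (2 ℕ.^ k)
    label i s = funToFin (neighbourhood i s)

    accepts : Fin (2 ℕ.^ k) → Fin n → Bool
    accepts t j = toBool (finToFun t (offset j))

    adj-factors : ∀ i j → Adj i j ≡ accepts (label i (block j)) j
    adj-factors i j = sym (begin
      toBool (finToFun (funToFin (neighbourhood i (block j))) (offset j))
        ≡⟨ cong toBool (finToFun-funToFin (neighbourhood i (block j)) (offset j)) ⟩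
      toBool (fromBool (extend slot (Adj i) (combine (block j) (offset j))))
        ≡⟨ toBool∘fromBool _ ⟩
      extend slot (Adj i) (combine (block j) (offset j))
        ≡⟨ cong (extend slot (Adj i)) (combine-remQuot {b} k (slot j)) ⟩
      extend slot (Adj i) (slot j)
        ≡⟨ extend-∘ (inject≤-injective n≤bk n≤bk _ _) (Adj i) j ⟩
      Adj i j ∎)
      where open ≡-Reasoning

open import Data.Nat
open import Data.Nat.Properties
open import Data.Nat.DivMod using (_/_; _%_; m≡m%n+[m/n]*n; m%n<n; m/n*n≤m)
open import Data.Nat.Logarithm using (⌊log₂_⌋)
open import Data.Nat.Logarithm.Core using (⌊log2⌋)
open import Data.Nat.Induction using (<-wellFounded)
open import Data.Nat.Tactic.RingSolver using (solve-∀)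
open import Induction.WellFounded using (Acc; acc)
open import Data.Product using (Σ; _×_; _,_)
open import Relation.Binary.PropositionalEquality using (_≡_; cong; subst)

⌊n/2⌋+⌊n/2⌋≤n : ∀ n → ⌊ n /2⌋ + ⌊ n /2⌋ ≤ n
⌊n/2⌋+⌊n/2⌋≤n n =
  subst (⌊ n /2⌋ + ⌊ n /2⌋ ≤_) (⌊n/2⌋+⌈n/2⌉≡n n) (+-monoʳ-≤ ⌊ n /2⌋ (⌊n/2⌋≤⌈n/2⌉ n))

n≤2*suc⌊n/2⌋ : ∀ n → n ≤ 2 * suc ⌊ n /2⌋
n≤2*suc⌊n/2⌋ n = begin
  n                         ≡⟨ ⌊n/2⌋+⌈n/2⌉≡n n ⟨
  ⌊ n /2⌋ + ⌈ n /2⌉         ≤⟨ +-mono-≤ (n≤1+n ⌊ n /2⌋) (⌊n/2⌋-mono (n≤1+n (suc n))) ⟩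
  suc ⌊ n /2⌋ + suc ⌊ n /2⌋ ≡⟨ cong (suc ⌊ n /2⌋ +_) (+-identityʳ (suc ⌊ n /2⌋)) ⟨
  2 * suc ⌊ n /2⌋           ∎
  where open ≤-Reasoning

2^⌊log2⌋≤n : ∀ n (rec : Acc _<_ (suc n)) → 2 ^ ⌊log2⌋ (suc n) rec ≤ suc n
2^⌊log2⌋≤n zero    _        = ≤-refl
2^⌊log2⌋≤n (suc n) (acc rs) = begin
  2 * 2 ^ ⌊log2⌋ (suc ⌊ n /2⌋) _  ≤⟨ *-monoʳ-≤ 2 (2^⌊log2⌋≤n ⌊ n /2⌋ _) ⟩
  2 * suc ⌊ n /2⌋                  ≡⟨ double-suc ⌊ n /2⌋ ⟩
  suc (suc (⌊ n /2⌋ + ⌊ n /2⌋))    ≤⟨ s≤s (s≤s (⌊n/2⌋+⌊n/2⌋≤n n)) ⟩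
  suc (suc n)                      ∎
  where
  open ≤-Reasoning
  double-suc : ∀ x → 2 * suc x ≡ suc (suc (x + x))
  double-suc = solve-∀

2^⌊log₂n⌋≤n : ∀ n .{{_ : NonZero n}} → 2 ^ ⌊log₂ n ⌋ ≤ n
2^⌊log₂n⌋≤n (suc n) = 2^⌊log2⌋≤n n (<-wellFounded (suc n))

n<2^n : ∀ n → n < 2 ^ n
n<2^n zero    = ≤-refl
n<2^n (suc n) = begin
  suc (suc n)     ≤⟨ s≤s (m≤n+m (suc n) n) ⟩
  suc (n + suc n) ≡⟨ cong suc (cong (n +_) (+-identityʳ (suc n))) ⟨
  2 * suc n       ≤⟨ *-monoʳ-≤ 2 (n<2^n n) ⟩
  2 * 2 ^ n       ∎
  where open ≤-Reasoning

size-estimate : ∀ {n b k p L} → L ≤ 2 * k → k ≤ p → p * p ≤ n → b * k ≤ 2 * n →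
                (b * n + 2 * p * n) * L ≤ 8 * (n * n)
size-estimate {n} {b} {k} {p} {L} L≤2k k≤p p²≤n bk≤2n = begin
  (b * n + 2 * p * n) * L             ≤⟨ *-monoʳ-≤ (b * n + 2 * p * n) L≤2k ⟩
  (b * n + 2 * p * n) * (2 * k)       ≡⟨ expand b n p k ⟩
  2 * n * (b * k) + 4 * n * (p * k)   ≤⟨ +-mono-≤ (*-monoʳ-≤ (2 * n) bk≤2n)
                                                  (*-monoʳ-≤ (4 * n) (*-monoʳ-≤ p k≤p)) ⟩
  2 * n * (2 * n) + 4 * n * (p * p)   ≤⟨ +-monoʳ-≤ (2 * n * (2 * n)) (*-monoʳ-≤ (4 * n) p²≤n) ⟩
  2 * n * (2 * n) + 4 * n * n         ≡⟨ collect n ⟩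
  8 * (n * n)                         ∎
  where
  open ≤-Reasoning
  expand : ∀ b n p k → (b * n + 2 * p * n) * (2 * k) ≡ 2 * n * (b * k) + 4 * n * (p * k)
  expand = solve-∀
  collect : ∀ n → 2 * n * (2 * n) + 4 * n * n ≡ 8 * (n * n)
  collect = solve-∀

halfLog : ℕ → ℕ
halfLog n = ⌊ ⌊log₂ n ⌋ /2⌋

blockSize : ℕ → ℕ
blockSize n = suc (halfLog n)

blockCount : ℕ → ℕ
blockCount n = suc (n / blockSize n)

n≤blockCount*blockSize : ∀ n → n ≤ blockCount n * blockSize n
n≤blockCount*blockSize n = begin
  n                 ≡⟨ m≡m%n+[m/n]*n n k ⟩
  n % k + n / k * k ≤⟨ +-monoˡ-≤ (n / k * k) (<⇒≤ (m%n<n n k)) ⟩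
  k + n / k * k     ∎
  where
  open ≤-Reasoning
  k : ℕ
  k = blockSize n

size-bound : ∀ n → (blockCount n * n + 2 ^ blockSize n * n) * ⌊log₂ n ⌋ ≤ 8 * (n * n)
size-bound zero       = ≤-reflexive (*-zeroʳ (blockCount 0 * 0 + 2 ^ blockSize 0 * 0))
size-bound n@(suc _)  = size-estimate {b = blockCount n} (n≤2*suc⌊n/2⌋ L) (n<2^n h) p²≤n bk≤2n
  where
  L : ℕ
  L = ⌊log₂ n ⌋
  h : ℕ
  h = halfLog n
  k : ℕ
  k = blockSize n
  p²≤n : 2 ^ h * 2 ^ h ≤ n
  p²≤n = begin
    2 ^ h * 2 ^ h ≡⟨ ^-distribˡ-+-* 2 h h ⟨
    2 ^ (h + h)   ≤⟨ ^-monoʳ-≤ 2 (⌊n/2⌋+⌊n/2⌋≤n L) ⟩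
    2 ^ L         ≤⟨ 2^⌊log₂n⌋≤n n ⟩
    n             ∎
    where open ≤-Reasoning
  k≤n : k ≤ n
  k≤n = ≤-trans (n<2^n h) (≤-trans (m≤m*n (2 ^ h) (2 ^ h) {{m^n≢0 2 h}}) p²≤n)
  bk≤2n : blockCount n * k ≤ 2 * n
  bk≤2n = begin
    k + n / k * k  ≤⟨ +-mono-≤ k≤n (m/n*n≤m n k) ⟩
    n + n          ≡⟨ cong (n +_) (+-identityʳ n) ⟨
    2 * n          ∎
    where open ≤-Reasoning

open ExtendedFormulation using (module FactorisationExtension; blockFactorisation)

lemma3p4 : Σ ℕ λ C → ∀ (n : ℕ) (G : Graph n) →
    Σ (Extension n) λ X →
      IsExtensionOf X (InEdgePolytope G) × (Extension.size X * ⌊log₂ n ⌋ ≤ C * (n * n))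
lemma3p4 = 8 , λ n G →
  let open FactorisationExtension (blockFactorisation G (blockSize n) (blockCount n) (n≤blockCount*blockSize n))
  in extension , isExtension , size-bound n
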